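{- Let $N$ be a fixed positive integer. There is a sequence of integers $a_1,a_2,\ldots$ such that for every number of selections $s\ge1$, an optimal strategy for the problem with $s$ selections is the $(a_s,a_{s-1},\ldots,a_1)$-strategy. In other words, the $(s+1-i)$-th threshold $k_{s+1-i}$ of an optimal positional strategy (the $i$-th from the right) can be taken independent of $s$ and equal to $a_i$, for $1\le i\le s$.
   Context: Setting: $N$ applicants labeled $1,\dots,N$ by quality ($N$ best); interview order a uniformly random $\pi\in S_N$ revealed from the left, decisions depending only on relative orders of the applicants seen so far; $s$ selections, each applicant irrevocably accepted (using a selection) or rejected; win if a selected applicant is the best; optimal = maximizing the winning probability. For $0\le k_1\le\cdots\le k_s\le N$, the $(k_1,\ldots,k_s)$-strategy is: for the $i$-th selection ($1\le i\le s$), wait until the $(i-1)$-th selection has been made (if $i\ge2$), reject the first $k_i$ applicants, and accept the next applicant that is a left-to-right maximum (better than all previously seen applicants). -}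

module Defs where

open import Data.Nat using (ℕ; zero; suc; _+_; _∸_; _≤_; _<_; _≤ᵇ_; _<ᵇ_; _≡ᵇ_)
open import Data.Bool using (Bool; true; false; _∧_; _∨_; if_then_else_)
open import Data.List using (List; []; _∷_; _++_; [_]; length; map; concatMap; reverse)

-- Applicants are labelled 1..N by quality (N best); an interview order is
-- a permutation of [1, ..., N] given as a list (first element interviewed first).

oneTo : ℕ → List ℕ
oneTo zero    = []
oneTo (suc n) = oneTo n ++ [ suc n ]

insertions : ℕ → List ℕ → List (List ℕ)
insertions x []       = (x ∷ []) ∷ []
insertions x (y ∷ ys) = (x ∷ y ∷ ys) ∷ map (y ∷_) (insertions x ys)

perms : List ℕ → List (List ℕ)
perms []       = [] ∷ []
perms (x ∷ xs) = concatMap (insertions x) (perms xs)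

allOrders : ℕ → List (List ℕ)
allOrders N = perms (oneTo N)

countLe : ℕ → List ℕ → ℕ
countLe x []       = 0
countLe x (y ∷ ys) = (if y ≤ᵇ x then 1 else 0) + countLe x ys

-- relative-order pattern of the applicants seen so far: each seen applicant is
-- replaced by its rank (1 = worst) among the seen applicants.
relPattern : List ℕ → List ℕ
relPattern xs = map (λ x → countLe x xs) xs

-- A (deterministic) strategy: given the number of selections made so far and the
-- relative-order pattern of the applicants seen so far (the current one last),
-- decide whether to accept the current applicant.
Strategy : Set
Strategy = ℕ → List ℕ → Bool

-- run a strategy with `rem` selections remaining and `made` made;
-- `seen` = applicants seen before, in order; returns the accepted applicants.
run : Strategy → ℕ → ℕ → List ℕ → List ℕ → List ℕ
run S rem made seen []       = []
run S zero made seen (x ∷ xs) = []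
run S (suc r) made seen (x ∷ xs) with S made (relPattern (seen ++ [ x ]))
... | true  = x ∷ run S r (suc made) (seen ++ [ x ]) xs
... | false = run S (suc r) made (seen ++ [ x ]) xs

memb : ℕ → List ℕ → Bool
memb x []       = false
memb x (y ∷ ys) = (x ≡ᵇ y) ∨ memb x ys

-- win: the best applicant N is among the selected ones
wins : ℕ → Strategy → ℕ → List ℕ → Bool
wins N S s π = memb N (run S s 0 [] π)

countTrue : List Bool → ℕ
countTrue []           = 0
countTrue (true ∷ bs)  = suc (countTrue bs)
countTrue (false ∷ bs) = countTrue bs

-- number of interview orders (out of N!) on which S with s selections wins;
-- the winning probability is this divided by N!.
winCount : ℕ → ℕ → Strategy → ℕ
winCount N s S = countTrue (map (wins N S s) (allOrders N))

Optimal : ℕ → ℕ → Strategy → Set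
Optimal N s S = ∀ (T : Strategy) → winCount N s T ≤ winCount N s S

nth : List ℕ → ℕ → ℕ
nth []       _       = 0
nth (x ∷ xs) zero    = x
nth (x ∷ xs) (suc i) = nth xs i

lastOr0 : List ℕ → ℕ
lastOr0 []           = 0
lastOr0 (x ∷ [])     = x
lastOr0 (x ∷ y ∷ ys) = lastOr0 (y ∷ ys)

-- current applicant is a left-to-right maximum iff its rank among seen = number seen
isLRMax : List ℕ → Bool
isLRMax p = lastOr0 p ≡ᵇ length p

-- the (k_1,...,k_s)-strategy, ks = [k_1, ..., k_s]: for the (made+1)-th selection,
-- reject the first k_{made+1} applicants (positions 1..k), accept the next
-- left-to-right maximum.
thresholdStrategy : List ℕ → Strategy
thresholdStrategy ks made p =
  (made <ᵇ length ks) ∧ ((nth ks made <ᵇ length p) ∧ isLRMax p)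

-- [a s, a (s-1), ..., a 1]  (the sequence a is indexed from 1)
revThresholds : (ℕ → ℕ) → ℕ → List ℕ
revThresholds a zero    = []
revThresholds a (suc s) = a (suc s) ∷ revThresholds a s

-- Encode an interview order by its arrival codes: the code of an arrival is the number of
-- earlier applicants it beats.  Orders correspond bijectively to code sequences, a
-- strategy sees only codes, and an arrival is a record iff its code is maximal.  Counting
-- winning code sequences gives a Bellman recursion bestWins r t n (r selections left,
-- t applicants seen, n to come) that bounds every strategy.  bestWins is concave in r;
-- hence a record that is better rejected with r + 1 selections left is also better
-- rejected with r left, and one better rejected after t + 1 applicants is also better
-- rejected after t.  So with r selections left it is optimal to accept exactly the
-- records after the first a_r applicants, where a_r does not depend on s and decreases
-- in r; this threshold strategy attains the bound.

module Submission where

open import Defs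
import Algebra.Properties.CommutativeSemigroup as CommSemigroupProperties
open import Data.Bool using (Bool; true; false; _∧_; _∨_; not; if_then_else_; T)
open import Data.Bool.Properties using (∧-zeroʳ; ∧-identityʳ)
open import Data.Empty using (⊥-elim)
open import Data.List using (List; []; _∷_; _++_; [_]; length; map; concatMap)
open import Data.List.Properties using (length-++; length-map; map-++; map-∘; map-cong-local; ++-assoc)
open import Data.List.Membership.Propositional using (_∈_; _∉_)
open import Data.List.Membership.Propositional.Properties
  using (∈-map⁺; ∈-map⁻; ∈-++⁻; ∈-++⁺ˡ; ∈-++⁺ʳ)
open import Data.List.Relation.Binary.Permutation.Propositional
  using (_↭_; prep; swap; ↭-refl; ↭-sym; ↭-trans) renaming (refl to ↭-refl′; trans to ↭-trans′)
open import Data.List.Relation.Binary.Permutation.Propositional.Properties using (∈-resp-↭; All-resp-↭)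
open import Data.List.Relation.Unary.All using (All; []; _∷_)
open import Data.List.Relation.Unary.Any using (here; there)
import Data.List.Relation.Unary.All as All
import Data.List.Relation.Unary.All.Properties as AllP
open import Data.Nat
  using (ℕ; zero; suc; _+_; _*_; _∸_; _⊔_; _≤_; _<_; _≤ᵇ_; _<ᵇ_; _≡ᵇ_; z≤n; s≤s; _≟_)
open import Data.Nat.Properties
open import Data.Product using (∃; _×_; _,_; proj₁)
open import Data.Sum using (inj₁; inj₂)
open import Data.Unit using (⊤; tt)
open import Function using (_∘_)
open import Relation.Binary.Definitions using (tri<; tri≈; tri>)
open import Relation.Nullary using (¬_; yes; no)
open import Relation.Binary.PropositionalEquality
  using (_≡_; _≢_; refl; sym; trans; cong; cong₂; subst; module ≡-Reasoning)

open CommSemigroupProperties +-commutativeSemigroup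
  using (interchange; xy∙z≈xz∙y; x∙yz≈y∙xz; xy∙z≈x∙zy)

private
  variable
    A B : Set

T⇒≡true : ∀ {b} → T b → b ≡ true
T⇒≡true {true} _ = refl

≡true⇒T : ∀ {b} → b ≡ true → T b
≡true⇒T refl = _

¬T⇒≡false : ∀ {b} → ¬ T b → b ≡ false
¬T⇒≡false {false} _  = refl
¬T⇒≡false {true}  ¬t = ⊥-elim (¬t _)

<ᵇ-true : ∀ {m n} → m < n → (m <ᵇ n) ≡ true
<ᵇ-true = T⇒≡true ∘ <⇒<ᵇ

<ᵇ-false : ∀ {m n} → n ≤ m → (m <ᵇ n) ≡ false
<ᵇ-false n≤m = ¬T⇒≡false (λ t → <⇒≱ (<ᵇ⇒< _ _ t) n≤m)

<ᵇ-true⇒< : ∀ {m n} → (m <ᵇ n) ≡ true → m < n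
<ᵇ-true⇒< = <ᵇ⇒< _ _ ∘ ≡true⇒T

≤ᵇ-true : ∀ {m n} → m ≤ n → (m ≤ᵇ n) ≡ true
≤ᵇ-true = T⇒≡true ∘ ≤⇒≤ᵇ

≤ᵇ-false : ∀ {m n} → n < m → (m ≤ᵇ n) ≡ false
≤ᵇ-false n<m = ¬T⇒≡false (λ t → <⇒≱ n<m (≤ᵇ⇒≤ _ _ t))

≤ᵇ-true⇒≤ : ∀ m n → (m ≤ᵇ n) ≡ true → m ≤ n
≤ᵇ-true⇒≤ m n = ≤ᵇ⇒≤ m n ∘ ≡true⇒T

<ᵇ-false⇒≥ : ∀ {m n} → (m <ᵇ n) ≡ false → n ≤ m
<ᵇ-false⇒≥ m≮n = ≮⇒≥ (subst T m≮n ∘ <⇒<ᵇ)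

≡ᵇ-refl : ∀ m → (m ≡ᵇ m) ≡ true
≡ᵇ-refl m = T⇒≡true (≡⇒≡ᵇ m m refl)

≡ᵇ-false : ∀ {m n} → m ≢ n → (m ≡ᵇ n) ≡ false
≡ᵇ-false m≢n = ¬T⇒≡false (m≢n ∘ ≡ᵇ⇒≡ _ _)

≡ᵇ-true⇒≡ : ∀ {m n} → (m ≡ᵇ n) ≡ true → m ≡ n
≡ᵇ-true⇒≡ = ≡ᵇ⇒≡ _ _ ∘ ≡true⇒T

bit : Bool → ℕ
bit true  = 1
bit false = 0

bit-∨ : ∀ a b → bit (a ∨ b) ≤ bit a + bit b
bit-∨ true  b = s≤s z≤n
bit-∨ false b = ≤-refl

bit-∨-disjoint : ∀ a b → (a ≡ true → b ≡ false) → bit (a ∨ b) ≡ bit a + bit b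
bit-∨-disjoint true  b a⇒¬b rewrite a⇒¬b refl = refl
bit-∨-disjoint false b _    = refl

∑ : List A → (A → ℕ) → ℕ
∑ []       f = 0
∑ (x ∷ xs) f = f x + ∑ xs f

∑-++ : ∀ (xs ys : List A) f → ∑ (xs ++ ys) f ≡ ∑ xs f + ∑ ys f
∑-++ []       ys f = refl
∑-++ (x ∷ xs) ys f = trans (cong (f x +_) (∑-++ xs ys f)) (sym (+-assoc (f x) _ _))

∑-map : ∀ (g : A → B) xs f → ∑ (map g xs) f ≡ ∑ xs (f ∘ g)
∑-map g []       f = refl
∑-map g (x ∷ xs) f = cong (f (g x) +_) (∑-map g xs f)

∑-concatMap : ∀ (g : A → List B) xs f → ∑ (concatMap g xs) f ≡ ∑ xs (λ x → ∑ (g x) f)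
∑-concatMap g []       f = refl
∑-concatMap g (x ∷ xs) f =
  trans (∑-++ (g x) (concatMap g xs) f) (cong (∑ (g x) f +_) (∑-concatMap g xs f))

∑-cong : ∀ (xs : List A) {f g} → (∀ x → f x ≡ g x) → ∑ xs f ≡ ∑ xs g
∑-cong []       f≗g = refl
∑-cong (x ∷ xs) f≗g = cong₂ _+_ (f≗g x) (∑-cong xs f≗g)

∑-cong-All : ∀ {P : A → Set} {xs f g} → All P xs → (∀ {x} → P x → f x ≡ g x) → ∑ xs f ≡ ∑ xs g
∑-cong-All []         f≗g = refl
∑-cong-All (px ∷ pxs) f≗g = cong₂ _+_ (f≗g px) (∑-cong-All pxs f≗g)

∑-mono : ∀ (xs : List A) {f g} → (∀ x → f x ≤ g x) → ∑ xs f ≤ ∑ xs g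
∑-mono []       f≤g = z≤n
∑-mono (x ∷ xs) f≤g = +-mono-≤ (f≤g x) (∑-mono xs f≤g)

∑-mono-All : ∀ {P : A → Set} {xs f g} → All P xs → (∀ {x} → P x → f x ≤ g x) → ∑ xs f ≤ ∑ xs g
∑-mono-All []         f≤g = z≤n
∑-mono-All (px ∷ pxs) f≤g = +-mono-≤ (f≤g px) (∑-mono-All pxs f≤g)

∑-const : ∀ (xs : List A) c → ∑ xs (λ _ → c) ≡ length xs * c
∑-const []       c = refl
∑-const (x ∷ xs) c = cong (c +_) (∑-const xs c)

∑-zero : ∀ (xs : List A) {f} → (∀ x → f x ≡ 0) → ∑ xs f ≡ 0
∑-zero []       f≗0 = refl
∑-zero (x ∷ xs) f≗0 rewrite f≗0 x = ∑-zero xs f≗0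

∑-+ : ∀ (xs : List A) f g → ∑ xs (λ x → f x + g x) ≡ ∑ xs f + ∑ xs g
∑-+ []       f g = refl
∑-+ (x ∷ xs) f g =
  trans (cong (f x + g x +_) (∑-+ xs f g)) (interchange (f x) (g x) (∑ xs f) (∑ xs g))

countTrue≡∑bit : ∀ bs → countTrue bs ≡ ∑ bs bit
countTrue≡∑bit []           = refl
countTrue≡∑bit (true ∷ bs)  = cong suc (countTrue≡∑bit bs)
countTrue≡∑bit (false ∷ bs) = countTrue≡∑bit bs

range : ℕ → List ℕ
range zero    = []
range (suc k) = 0 ∷ map suc (range k)

range-suc : ∀ k → range (suc k) ≡ range k ++ [ k ]
range-suc zero    = refl
range-suc (suc k) = cong (0 ∷_) (trans (cong (map suc) (range-suc k)) (map-++ suc (range k) [ k ]))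

length-range : ∀ k → length (range k) ≡ k
length-range zero    = refl
length-range (suc k) = cong suc (trans (length-map suc (range k)) (length-range k))

range-< : ∀ k → All (_< k) (range k)
range-< zero    = []
range-< (suc k) = s≤s z≤n ∷ AllP.map⁺ (All.map s≤s (range-< k))

∑-range-suc : ∀ k f → ∑ (range (suc k)) f ≡ ∑ (range k) f + f k
∑-range-suc k f = begin
  ∑ (range (suc k)) f       ≡⟨ cong (λ xs → ∑ xs f) (range-suc k) ⟩
  ∑ (range k ++ [ k ]) f    ≡⟨ ∑-++ (range k) [ k ] f ⟩
  ∑ (range k) f + (f k + 0) ≡⟨ cong (∑ (range k) f +_) (+-identityʳ (f k)) ⟩
  ∑ (range k) f + f k       ∎
  where open ≡-Reasoning

∑-range-≤ : ∀ k f c → (∀ x → x < k → f x ≤ c) → ∑ (range k) f ≤ k * c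
∑-range-≤ k f c f≤c = begin
  ∑ (range k) f          ≤⟨ ∑-mono-All (range-< k) (f≤c _) ⟩
  ∑ (range k) (λ _ → c)  ≡⟨ ∑-const (range k) c ⟩
  length (range k) * c   ≡⟨ cong (_* c) (length-range k) ⟩
  k * c                  ∎
  where open ≤-Reasoning

∑-range-const : ∀ k f c → (∀ x → x < k → f x ≡ c) → ∑ (range k) f ≡ k * c
∑-range-const k f c f≡c = begin
  ∑ (range k) f          ≡⟨ ∑-cong-All (range-< k) (f≡c _) ⟩
  ∑ (range k) (λ _ → c)  ≡⟨ ∑-const (range k) c ⟩
  length (range k) * c   ≡⟨ cong (_* c) (length-range k) ⟩
  k * c                  ∎
  where open ≡-Reasoning

-- The arrival after t applicants beats between 0 and t of them; it is a record iff it beats t.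
codes : ℕ → ℕ → List (List ℕ)
codes t zero    = [] ∷ []
codes t (suc n) = concatMap (λ x → map (x ∷_) (codes (suc t) n)) (range (suc t))

∑-codes-suc : ∀ t n f →
  ∑ (codes t (suc n)) f ≡ ∑ (range (suc t)) (λ x → ∑ (codes (suc t) n) (f ∘ (x ∷_)))
∑-codes-suc t n f =
  trans (∑-concatMap (λ x → map (x ∷_) (codes (suc t) n)) (range (suc t)) f)
        (∑-cong (range (suc t)) (λ x → ∑-map (x ∷_) (codes (suc t) n) f))

∑-codes-split : ∀ t n f →
  ∑ (codes t (suc n)) f ≡
  ∑ (range t) (λ x → ∑ (codes (suc t) n) (f ∘ (x ∷_))) + ∑ (codes (suc t) n) (f ∘ (t ∷_))
∑-codes-split t n f = trans (∑-codes-suc t n f) (∑-range-suc t _)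

rising : ℕ → ℕ → ℕ
rising t zero    = 1
rising t (suc n) = t * rising (suc t) n

noRecord : ℕ → List ℕ → Bool
noRecord t []       = true
noRecord t (x ∷ xs) = not (x ≡ᵇ t) ∧ noRecord (suc t) xs

∑-noRecord : ∀ n t → ∑ (codes t n) (bit ∘ noRecord t) ≡ rising t n
∑-noRecord zero    t = refl
∑-noRecord (suc n) t =
  trans (∑-codes-split t n _)
        (trans (cong₂ _+_ (∑-range-const t _ _ nonRecord) atRecord) (+-identityʳ _))
  where
  nonRecord : ∀ x → x < t →
    ∑ (codes (suc t) n) (λ ρ → bit (not (x ≡ᵇ t) ∧ noRecord (suc t) ρ)) ≡ rising (suc t) n
  nonRecord x x<t rewrite ≡ᵇ-false (<⇒≢ x<t) = ∑-noRecord n (suc t)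
  atRecord : ∑ (codes (suc t) n) (λ ρ → bit (not (t ≡ᵇ t) ∧ noRecord (suc t) ρ)) ≡ 0
  atRecord rewrite ≡ᵇ-refl t = ∑-zero (codes (suc t) n) (λ _ → refl)

-- Bellman equation: t of the t + 1 possible codes of the next arrival are not records;
-- a record is either accepted (a win iff no later record, otherwise play on with r
-- selections) or rejected.
bestWins : (r t n : ℕ) → ℕ
bestWins zero    t n       = 0
bestWins (suc r) t zero    = 0
bestWins (suc r) t (suc n) =
  t * bestWins (suc r) (suc t) n
  + ((rising (suc t) n + bestWins r (suc t) n) ⊔ bestWins (suc r) (suc t) n)

bestWins-zero : ∀ r t → bestWins r t 0 ≡ 0
bestWins-zero zero    t = refl
bestWins-zero (suc r) t = refl

bestWins-mono : ∀ n r t → bestWins r t n ≤ bestWins (suc r) t n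
bestWins-mono n       zero    t = z≤n
bestWins-mono zero    (suc r) t = ≤-refl
bestWins-mono (suc n) (suc r) t =
  +-mono-≤ (*-monoʳ-≤ t (bestWins-mono n (suc r) (suc t)))
           (⊔-mono-≤ (+-monoʳ-≤ (rising (suc t) n) (bestWins-mono n r (suc t)))
                     (bestWins-mono n (suc r) (suc t)))

bump : ℕ → ℕ → ℕ
bump c v = if c <ᵇ v then suc v else v

-- The relative pattern after an arrival that beats c of the applicants seen.
extend : ℕ → List ℕ → List ℕ
extend c pat = map (bump c) pat ++ [ suc c ]

-- S plays with r selections left after made selections, pat is the relative pattern of
-- the t applicants seen and the argument list holds the codes of the remaining ones.
-- An arrival is the best of all iff it is a record and no later arrival is.
winsFrom : Strategy → ℕ → ℕ → List ℕ → ℕ → List ℕ → Bool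
winsFrom S r       made pat t []       = false
winsFrom S zero    made pat t (x ∷ xs) = false
winsFrom S (suc r) made pat t (x ∷ xs) =
  if S made (extend x pat)
  then ((x ≡ᵇ t) ∧ noRecord (suc t) xs) ∨ winsFrom S r (suc made) (extend x pat) (suc t) xs
  else winsFrom S (suc r) made (extend x pat) (suc t) xs

winsFrom-zero : ∀ S made pat t ρ → winsFrom S zero made pat t ρ ≡ false
winsFrom-zero S made pat t []      = refl
winsFrom-zero S made pat t (x ∷ ρ) = refl

∑-winsFrom-≤-bestWins : ∀ S n r made pat t →
  ∑ (codes t n) (bit ∘ winsFrom S r made pat t) ≤ bestWins r t n
∑-winsFrom-≤-bestWins S zero    r       made pat t = z≤n
∑-winsFrom-≤-bestWins S (suc n) zero    made pat t =
  ≤-reflexive (∑-zero (codes t (suc n)) (cong bit ∘ winsFrom-zero S made pat t))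
∑-winsFrom-≤-bestWins S (suc n) (suc r) made pat t =
  ≤-trans (≤-reflexive (∑-codes-split t n _)) (+-mono-≤ (∑-range-≤ t _ _ nonRecord) atRecord)
  where
  L : List (List ℕ)
  L = codes (suc t) n
  IH : ∀ r made pat → ∑ L (bit ∘ winsFrom S r made pat (suc t)) ≤ bestWins r (suc t) n
  IH r made pat = ∑-winsFrom-≤-bestWins S n r made pat (suc t)
  nonRecord : ∀ x → x < t → ∑ L (λ ρ → bit (winsFrom S (suc r) made pat t (x ∷ ρ))) ≤ bestWins (suc r) (suc t) n
  nonRecord x x<t with S made (extend x pat)
  ... | true rewrite ≡ᵇ-false (<⇒≢ x<t) =
    ≤-trans (IH r (suc made) (extend x pat)) (bestWins-mono n r (suc t))
  ... | false = IH (suc r) made (extend x pat)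
  atRecord : ∑ L (λ ρ → bit (winsFrom S (suc r) made pat t (t ∷ ρ))) ≤
             (rising (suc t) n + bestWins r (suc t) n) ⊔ bestWins (suc r) (suc t) n
  atRecord with S made (extend t pat)
  ... | false = ≤-trans (IH (suc r) made (extend t pat)) (m≤n⊔m _ _)
  ... | true rewrite ≡ᵇ-refl t = begin
    ∑ L (λ ρ → bit (noRecord (suc t) ρ ∨ w ρ))
      ≤⟨ ∑-mono L (λ ρ → bit-∨ (noRecord (suc t) ρ) (w ρ)) ⟩
    ∑ L (λ ρ → bit (noRecord (suc t) ρ) + bit (w ρ))
      ≡⟨ ∑-+ L _ _ ⟩
    ∑ L (bit ∘ noRecord (suc t)) + ∑ L (bit ∘ w)
      ≤⟨ +-mono-≤ (≤-reflexive (∑-noRecord n (suc t))) (IH r (suc made) (extend t pat)) ⟩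
    rising (suc t) n + bestWins r (suc t) n
      ≤⟨ m≤m⊔n _ _ ⟩
    (rising (suc t) n + bestWins r (suc t) n) ⊔ bestWins (suc r) (suc t) n
      ∎
    where
    open ≤-Reasoning
    w : List ℕ → Bool
    w = winsFrom S r (suc made) (extend t pat) (suc t)

-- Concavity of the optimal number of wins in the number of selections

⊔-+-⊔-lub : ∀ {x y z v k} →
  x + z ≤ k → x + v ≤ k → y + z ≤ k → y + v ≤ k → (x ⊔ y) + (z ⊔ v) ≤ k
⊔-+-⊔-lub {x} {y} {z} {v} xz xv yz yv
  rewrite +-distribˡ-⊔ (x ⊔ y) z v | +-distribʳ-⊔ z x y | +-distribʳ-⊔ v x y =
  ⊔-lub (⊔-lub xz yz) (⊔-lub xv yv)

-- With b, c, d the values for j + 1, j + 2, j + 3 selections and a the value for j,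
-- the choice term (p + w(r − 1)) ⊔ w(r) of the Bellman equation inherits concavity.
choice-concave : ∀ p a b c d → d + b ≤ c + c → c + a ≤ b + b →
  ((p + c) ⊔ d) + ((p + a) ⊔ b) ≤ ((p + b) ⊔ c) + ((p + b) ⊔ c)
choice-concave p a b c d db≤cc ca≤bb = ⊔-+-⊔-lub {p + c} {d} {p + a} {b} pcpa pcb dpa db
  where
  open ≤-Reasoning
  M : ℕ
  M = (p + b) ⊔ c
  pb≤M : p + b ≤ M
  pb≤M = m≤m⊔n _ _
  c≤M : c ≤ M
  c≤M = m≤n⊔m _ _
  pbc≤MM : (p + b) + c ≤ M + M
  pbc≤MM = +-mono-≤ pb≤M c≤M
  da≤bc : d + a ≤ b + c
  da≤bc = +-cancelʳ-≤ (b + c) (d + a) (b + c) (begin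
    (d + a) + (b + c)  ≡⟨ interchange d a b c ⟩
    (d + b) + (a + c)  ≡⟨ cong ((d + b) +_) (+-comm a c) ⟩
    (d + b) + (c + a)  ≤⟨ +-mono-≤ db≤cc ca≤bb ⟩
    (c + c) + (b + b)  ≡⟨ interchange c c b b ⟩
    (c + b) + (c + b)  ≡⟨ cong₂ _+_ (+-comm c b) (+-comm c b) ⟩
    (b + c) + (b + c)  ∎)
  pcpa : (p + c) + (p + a) ≤ M + M
  pcpa = begin
    (p + c) + (p + a)  ≡⟨ interchange p c p a ⟩
    (p + p) + (c + a)  ≤⟨ +-monoʳ-≤ (p + p) ca≤bb ⟩
    (p + p) + (b + b)  ≡⟨ interchange p p b b ⟩
    (p + b) + (p + b)  ≤⟨ +-mono-≤ pb≤M pb≤M ⟩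
    M + M              ∎
  pcb : (p + c) + b ≤ M + M
  pcb = ≤-trans (≤-reflexive (xy∙z≈xz∙y p c b)) pbc≤MM
  dpa : d + (p + a) ≤ M + M
  dpa = begin
    d + (p + a)  ≡⟨ x∙yz≈y∙xz d p a ⟩
    p + (d + a)  ≤⟨ +-monoʳ-≤ p da≤bc ⟩
    p + (b + c)  ≡⟨ sym (+-assoc p b c) ⟩
    (p + b) + c  ≤⟨ pbc≤MM ⟩
    M + M        ∎
  db : d + b ≤ M + M
  db = ≤-trans db≤cc (+-mono-≤ c≤M c≤M)

choice-concave₀ : ∀ p w₁ w₂ → w₂ + 0 ≤ w₁ + w₁ →
  ((p + w₁) ⊔ w₂) + 0 ≤ ((p + 0) ⊔ w₁) + ((p + 0) ⊔ w₁)
choice-concave₀ p w₁ w₂ w₂≤2w₁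
  rewrite +-identityʳ ((p + w₁) ⊔ w₂) | +-identityʳ p | +-identityʳ w₂ =
  ⊔-lub (+-mono-≤ (m≤m⊔n p w₁) (m≤n⊔m p w₁))
        (≤-trans w₂≤2w₁ (+-mono-≤ (m≤n⊔m p w₁) (m≤n⊔m p w₁)))

*-+-midpoint : ∀ t a b c ea eb ec → a + b ≤ c + c → ea + eb ≤ ec + ec →
  (t * a + ea) + (t * b + eb) ≤ (t * c + ec) + (t * c + ec)
*-+-midpoint t a b c ea eb ec ab≤cc eab≤ecc = begin
  (t * a + ea) + (t * b + eb)  ≡⟨ interchange (t * a) ea (t * b) eb ⟩
  (t * a + t * b) + (ea + eb)  ≡⟨ cong (_+ (ea + eb)) (sym (*-distribˡ-+ t a b)) ⟩
  t * (a + b) + (ea + eb)      ≤⟨ +-mono-≤ (*-monoʳ-≤ t ab≤cc) eab≤ecc ⟩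
  t * (c + c) + (ec + ec)      ≡⟨ cong (_+ (ec + ec)) (*-distribˡ-+ t c c) ⟩
  (t * c + t * c) + (ec + ec)  ≡⟨ interchange (t * c) (t * c) ec ec ⟩
  (t * c + ec) + (t * c + ec)  ∎
  where open ≤-Reasoning

bestWins-concave : ∀ n t r →
  bestWins (suc (suc r)) t n + bestWins r t n ≤ bestWins (suc r) t n + bestWins (suc r) t n
bestWins-concave zero    t r rewrite bestWins-zero r t = z≤n
bestWins-concave (suc n) t zero =
  ≤-trans (≤-reflexive (cong (bestWins 2 t (suc n) +_) t*0+0≡0))
    (*-+-midpoint t _ 0 _ _ 0 _ (bestWins-concave n (suc t) zero)
      (choice-concave₀ (rising (suc t) n) _ _ (bestWins-concave n (suc t) zero)))
  where
  t*0+0≡0 : 0 ≡ t * 0 + 0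
  t*0+0≡0 = sym (trans (+-identityʳ (t * 0)) (*-zeroʳ t))
bestWins-concave (suc n) t (suc j) =
  *-+-midpoint t _ _ _ _ _ _ (bestWins-concave n (suc t) (suc j))
    (choice-concave (rising (suc t) n) _ _ _ _
      (bestWins-concave n (suc t) (suc j)) (bestWins-concave n (suc t) j))

RejectBetter : (r t n : ℕ) → Set
RejectBetter r t n = rising (suc t) n + bestWins r (suc t) n < bestWins (suc r) (suc t) n

+-<-concave : ∀ x a b c → x + b < c → c + a ≤ b + b → x + a < b
+-<-concave x a b c xb<c ca≤bb = +-cancelʳ-< c (x + a) b (begin-strict
  (x + a) + c  ≡⟨ xy∙z≈x∙zy x a c ⟩
  x + (c + a)  ≤⟨ +-monoʳ-≤ x ca≤bb ⟩
  x + (b + b)  ≡⟨ sym (+-assoc x b b) ⟩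
  (x + b) + b  <⟨ +-monoˡ-< b xb<c ⟩
  c + b        ≡⟨ +-comm c b ⟩
  b + c        ∎)
  where open ≤-Reasoning

rejectBetter-fewer : ∀ r t n → RejectBetter (suc r) t n → RejectBetter r t n
rejectBetter-fewer r t n reject =
  +-<-concave (rising (suc t) n) _ _ _ reject (bestWins-concave n (suc t) r)

-- In the Bellman equation one step earlier both maxima are attained by rejection
-- (the second one by rejectBetter-fewer), and rising grows by the same factor.
rejectBetter-earlier : ∀ r t n → RejectBetter r (suc t) n → RejectBetter r t (suc n)
rejectBetter-earlier zero t n reject rewrite m≤n⇒m⊔n≡n (<⇒≤ reject) = begin-strict
  suc t * p + 0  ≡⟨ +-identityʳ (suc t * p) ⟩
  suc t * p      <⟨ *-monoʳ-< (suc t) (≤-<-trans (≤-reflexive (sym (+-identityʳ p))) reject) ⟩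
  suc t * w₁     ≤⟨ m≤m+n (suc t * w₁) w₁ ⟩
  suc t * w₁ + w₁ ∎
  where
  open ≤-Reasoning
  p w₁ : ℕ
  p  = rising (suc (suc t)) n
  w₁ = bestWins 1 (suc (suc t)) n
rejectBetter-earlier (suc j) t n reject
  rewrite m≤n⇒m⊔n≡n (<⇒≤ reject)
        | m≤n⇒m⊔n≡n (<⇒≤ (rejectBetter-fewer j (suc t) n reject)) = begin-strict
  suc t * p + (suc t * w + w)  ≡⟨ sym (+-assoc (suc t * p) (suc t * w) w) ⟩
  suc t * p + suc t * w + w    ≡⟨ cong (_+ w) (sym (*-distribˡ-+ (suc t) p w)) ⟩
  suc t * (p + w) + w          <⟨ +-mono-≤-< (*-monoʳ-≤ (suc t) (<⇒≤ reject)) (≤-<-trans (m≤n+m w p) reject) ⟩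
  suc t * w′ + w′              ∎
  where
  open ≤-Reasoning
  p w w′ : ℕ
  p  = rising (suc (suc t)) n
  w  = bestWins (suc j) (suc (suc t)) n
  w′ = bestWins (suc (suc j)) (suc (suc t)) n

rejectBetterᵇ : (N r t : ℕ) → Bool
rejectBetterᵇ N r t =
  (rising (suc t) (N ∸ suc t) + bestWins r (suc t) (N ∸ suc t))
    <ᵇ bestWins (suc r) (suc t) (N ∸ suc t)

rejectBetterᵇ-≡ : ∀ N r t n → t + suc n ≡ N →
  rejectBetterᵇ N r t ≡ ((rising (suc t) n + bestWins r (suc t) n) <ᵇ bestWins (suc r) (suc t) n)
rejectBetterᵇ-≡ N r t n refl rewrite +-suc t n | m+n∸m≡n (suc t) n = refl

∸-suc : ∀ {m n} → n < m → m ∸ n ≡ suc (m ∸ suc n)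
∸-suc {suc m} {zero}  _         = refl
∸-suc {suc m} {suc n} (s≤s n<m) = ∸-suc n<m

rejectBetterᵇ-earlier : ∀ N r t → suc t < N →
  rejectBetterᵇ N r (suc t) ≡ true → rejectBetterᵇ N r t ≡ true
rejectBetterᵇ-earlier N r t 1+t<N reject rewrite ∸-suc 1+t<N =
  <ᵇ-true (rejectBetter-earlier r t (N ∸ suc (suc t)) (<ᵇ-true⇒< reject))

rejectBetterᵇ-fewer : ∀ N r t → rejectBetterᵇ N (suc r) t ≡ true → rejectBetterᵇ N r t ≡ true
rejectBetterᵇ-fewer N r t reject =
  <ᵇ-true (rejectBetter-fewer r t (N ∸ suc t) (<ᵇ-true⇒< reject))

runLength : (ℕ → Bool) → ℕ → ℕ → ℕ
runLength B k zero    = 0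
runLength B k (suc m) = if B k then suc (runLength B (suc k) m) else 0

runLength-≤ : ∀ B k m → runLength B k m ≤ m
runLength-≤ B k zero    = z≤n
runLength-≤ B k (suc m) with B k
... | true  = s≤s (runLength-≤ B (suc k) m)
... | false = z≤n

runLength-mono : ∀ {B B′} → (∀ u → B u ≡ true → B′ u ≡ true) →
  ∀ k m → runLength B k m ≤ runLength B′ k m
runLength-mono         B⊆B′ k zero    = z≤n
runLength-mono {B} {B′} B⊆B′ k (suc m) with B k in Bk
... | false = z≤n
... | true rewrite B⊆B′ k Bk = s≤s (runLength-mono B⊆B′ (suc k) m)

runLength-sound : ∀ B k m u → u < runLength B k m → B (k + u) ≡ true
runLength-sound B k (suc m) u u<len with B k in Bk
runLength-sound B k (suc m) zero    _           | true rewrite +-identityʳ k = Bk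
runLength-sound B k (suc m) (suc u) (s≤s u<len) | true rewrite +-suc k u =
  runLength-sound B (suc k) m u u<len

runLength-complete : ∀ B k m u → (∀ v → v ≤ u → B (k + v) ≡ true) → u < m → u < runLength B k m
runLength-complete B k (suc m) u B≤u (s≤s u≤m) with B k in Bk
... | false = ⊥-elim (subst T Bk (≡true⇒T (subst (λ i → B i ≡ true) (+-identityʳ k) (B≤u 0 z≤n))))
runLength-complete B k (suc m) zero    B≤u (s≤s u≤m) | true = s≤s z≤n
runLength-complete B k (suc m) (suc u) B≤u (s≤s u≤m) | true =
  s≤s (runLength-complete B (suc k) m u B≤u′ u≤m)
  where
  B≤u′ : ∀ v → v ≤ u → B (suc k + v) ≡ true
  B≤u′ v v≤u = subst (λ i → B i ≡ true) (+-suc k v) (B≤u (suc v) (s≤s v≤u))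

true-downward : ∀ (B : ℕ → Bool) N → (∀ u → suc u < N → B (suc u) ≡ true → B u ≡ true) →
  ∀ t → t < N → B t ≡ true → ∀ v → v ≤ t → B v ≡ true
true-downward B N down zero    t<N Bt .zero z≤n = Bt
true-downward B N down (suc t) t<N Bt v v≤1+t with m≤n⇒m<n∨m≡n v≤1+t
... | inj₂ refl       = Bt
... | inj₁ (s≤s v≤t)  = true-downward B N down t (<-trans (n<1+n t) t<N) (down t t<N Bt) v v≤t

-- threshold N r is a_r.
threshold : ℕ → ℕ → ℕ
threshold N zero    = 0
threshold N (suc r) = runLength (rejectBetterᵇ N r) 0 N

threshold-1-≤ : ∀ N → threshold N 1 ≤ N
threshold-1-≤ N = runLength-≤ (rejectBetterᵇ N 0) 0 N

threshold-antitone : ∀ N i → 1 ≤ i → threshold N (suc i) ≤ threshold N i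
threshold-antitone N (suc r) _ = runLength-mono (rejectBetterᵇ-fewer N r) 0 N

accept-from-threshold : ∀ N r t n → t + suc n ≡ N → threshold N (suc r) ≤ t →
  bestWins (suc r) (suc t) n ≤ rising (suc t) n + bestWins r (suc t) n
accept-from-threshold N r t n t+1+n≡N a≤t = ≮⇒≥ λ reject →
  <⇒≱ (runLength-complete (rejectBetterᵇ N r) 0 N t
         (true-downward (rejectBetterᵇ N r) N (rejectBetterᵇ-earlier N r) t t<N
           (trans (rejectBetterᵇ-≡ N r t n t+1+n≡N) (<ᵇ-true reject)))
         t<N)
      a≤t
  where
  t<N : t < N
  t<N = subst (t <_) t+1+n≡N (m<m+n t (s≤s z≤n))

reject-before-threshold : ∀ N r t n → t + suc n ≡ N → t < threshold N (suc r) → RejectBetter r t n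
reject-before-threshold N r t n t+1+n≡N t<a = <ᵇ-true⇒< (begin
  (rising (suc t) n + bestWins r (suc t) n) <ᵇ bestWins (suc r) (suc t) n  ≡⟨ rejectBetterᵇ-≡ N r t n t+1+n≡N ⟨
  rejectBetterᵇ N r t                                                     ≡⟨ runLength-sound (rejectBetterᵇ N r) 0 N t t<a ⟩
  true                                                                    ∎)
  where open ≡-Reasoning

lastOr0-++ : ∀ xs v → lastOr0 (xs ++ [ v ]) ≡ v
lastOr0-++ []           v = refl
lastOr0-++ (x ∷ [])     v = refl
lastOr0-++ (x ∷ y ∷ ys) v = lastOr0-++ (y ∷ ys) v

length-++-[] : ∀ (xs : List ℕ) y → length (xs ++ [ y ]) ≡ suc (length xs)
length-++-[] xs y = trans (length-++ xs) (+-comm (length xs) 1)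

length-extend : ∀ c pat → length (extend c pat) ≡ suc (length pat)
length-extend c pat = trans (length-++-[] (map (bump c) pat) (suc c)) (cong suc (length-map (bump c) pat))

length-revThresholds : ∀ a s → length (revThresholds a s) ≡ s
length-revThresholds a zero    = refl
length-revThresholds a (suc s) = cong suc (length-revThresholds a s)

nth-revThresholds : ∀ a m r → nth (revThresholds a (m + suc r)) m ≡ a (suc r)
nth-revThresholds a zero    r = refl
nth-revThresholds a (suc m) r = nth-revThresholds a m r

thresholdStrategy-extend : ∀ a made r x pat →
  thresholdStrategy (revThresholds a (made + suc r)) made (extend x pat) ≡
  ((a (suc r) <ᵇ suc (length pat)) ∧ (x ≡ᵇ length pat))
thresholdStrategy-extend a made r x pat
  rewrite length-revThresholds a (made + suc r) | nth-revThresholds a made r | length-extend x pat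
        | lastOr0-++ (map (bump x) pat) (suc x) | <ᵇ-true (m<m+n made (s≤s (z≤n {r}))) = refl

noRecord⇒¬winsFrom : ∀ S r made pat t ρ → noRecord t ρ ≡ true → winsFrom S r made pat t ρ ≡ false
noRecord⇒¬winsFrom S r       made pat t []      _ = refl
noRecord⇒¬winsFrom S zero    made pat t (x ∷ ρ) _ = refl
noRecord⇒¬winsFrom S (suc r) made pat t (x ∷ ρ) noRec with x ≡ᵇ t | noRecord (suc t) ρ in noRec′
... | false | true with S made (extend x pat)
...   | true  = noRecord⇒¬winsFrom S r (suc made) (extend x pat) (suc t) ρ noRec′
...   | false = noRecord⇒¬winsFrom S (suc r) made (extend x pat) (suc t) ρ noRec′

module _ (N : ℕ) (a : ℕ → ℕ)
  (accept : ∀ r t n → t + suc n ≡ N → a (suc r) ≤ t →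
            bestWins (suc r) (suc t) n ≤ rising (suc t) n + bestWins r (suc t) n)
  (reject : ∀ r t n → t + suc n ≡ N → t < a (suc r) → RejectBetter r t n)
  where

  strategy : ℕ → Strategy
  strategy s = thresholdStrategy (revThresholds a s)

  ∑-winsFrom-threshold≡bestWins : ∀ n r made pat → length pat + n ≡ N →
    ∑ (codes (length pat) n) (bit ∘ winsFrom (strategy (made + r)) r made pat (length pat))
      ≡ bestWins r (length pat) n
  ∑-winsFrom-threshold≡bestWins zero    r       made pat _ = sym (bestWins-zero r (length pat))
  ∑-winsFrom-threshold≡bestWins (suc n) zero    made pat _ =
    ∑-zero (codes (length pat) (suc n)) (cong bit ∘ winsFrom-zero _ made pat (length pat))
  ∑-winsFrom-threshold≡bestWins (suc n) (suc r) made pat t+1+n≡N =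
    trans (∑-codes-split t n _) (cong₂ _+_ (∑-range-const t _ _ nonRecord) atRecord)
    where
    t : ℕ
    t = length pat
    L : List (List ℕ)
    L = codes (suc t) n
    S : Strategy
    S = strategy (made + suc r)
    IH : ∀ r made x → ∑ L (bit ∘ winsFrom (strategy (made + r)) r made (extend x pat) (suc t)) ≡ bestWins r (suc t) n
    IH r made x =
      subst (λ u → ∑ (codes u n) (bit ∘ winsFrom (strategy (made + r)) r made (extend x pat) u) ≡ bestWins r u n)
            (length-extend x pat)
            (∑-winsFrom-threshold≡bestWins n r made (extend x pat)
              (trans (cong (_+ n) (length-extend x pat)) (trans (sym (+-suc t n)) t+1+n≡N)))
    w : List ℕ → Bool
    w = winsFrom S r (suc made) (extend t pat) (suc t)
    afterAccept : ∑ L (bit ∘ w) ≡ bestWins r (suc t) n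
    afterAccept =
      subst (λ m → ∑ L (bit ∘ winsFrom (strategy m) r (suc made) (extend t pat) (suc t)) ≡ bestWins r (suc t) n)
            (sym (+-suc made r)) (IH r (suc made) t)
    nonRecord : ∀ x → x < t → ∑ L (λ ρ → bit (winsFrom S (suc r) made pat t (x ∷ ρ))) ≡ bestWins (suc r) (suc t) n
    nonRecord x x<t
      rewrite thresholdStrategy-extend a made r x pat | ≡ᵇ-false (<⇒≢ x<t) | ∧-zeroʳ (a (suc r) <ᵇ suc t) =
      IH (suc r) made x
    atRecord : ∑ L (λ ρ → bit (winsFrom S (suc r) made pat t (t ∷ ρ)))
               ≡ (rising (suc t) n + bestWins r (suc t) n) ⊔ bestWins (suc r) (suc t) n
    atRecord rewrite thresholdStrategy-extend a made r t pat | ≡ᵇ-refl t | ∧-identityʳ (a (suc r) <ᵇ suc t)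
      with a (suc r) <ᵇ suc t in a≤t
    ... | false = trans (IH (suc r) made t) (sym (m≤n⇒m⊔n≡n (<⇒≤ (reject r t n t+1+n≡N (<ᵇ-false⇒≥ a≤t)))))
    ... | true  = begin
      ∑ L (λ ρ → bit (noRecord (suc t) ρ ∨ w ρ))
        ≡⟨ ∑-cong L (λ ρ → bit-∨-disjoint (noRecord (suc t) ρ) (w ρ)
                             (noRecord⇒¬winsFrom S r (suc made) (extend t pat) (suc t) ρ)) ⟩
      ∑ L (λ ρ → bit (noRecord (suc t) ρ) + bit (w ρ))
        ≡⟨ ∑-+ L _ _ ⟩
      ∑ L (bit ∘ noRecord (suc t)) + ∑ L (bit ∘ w)
        ≡⟨ cong₂ _+_ (∑-noRecord n (suc t)) afterAccept ⟩
      rising (suc t) n + bestWins r (suc t) n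
        ≡⟨ m≥n⇒m⊔n≡m (accept r t n t+1+n≡N (≤-pred (<ᵇ-true⇒< a≤t))) ⟨
      (rising (suc t) n + bestWins r (suc t) n) ⊔ bestWins (suc r) (suc t) n
        ∎
      where open ≡-Reasoning

arrivalCodes : List ℕ → List ℕ → List ℕ
arrivalCodes seen []       = []
arrivalCodes seen (y ∷ ys) = countLe y seen ∷ arrivalCodes (seen ++ [ y ]) ys

-- The codes of all the orders obtained by inserting a new worst applicant into an
-- order with codes ρ: every later applicant beats it.
insertWorst : List ℕ → List (List ℕ)
insertWorst []       = (0 ∷ []) ∷ []
insertWorst (x ∷ xs) = (0 ∷ suc x ∷ map suc xs) ∷ map (x ∷_) (insertWorst xs)

permCodes : ℕ → List (List ℕ)
permCodes zero    = [] ∷ []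
permCodes (suc N) = concatMap insertWorst (permCodes N)

countLe-++ : ∀ y xs ys → countLe y (xs ++ ys) ≡ countLe y xs + countLe y ys
countLe-++ y []       ys = refl
countLe-++ y (x ∷ xs) ys = trans (cong (b +_) (countLe-++ y xs ys)) (sym (+-assoc b _ _))
  where
  b : ℕ
  b = if x ≤ᵇ y then 1 else 0

≤ᵇ-suc : ∀ x y → (suc x ≤ᵇ suc y) ≡ (x ≤ᵇ y)
≤ᵇ-suc zero    y = refl
≤ᵇ-suc (suc x) y = refl

countLe-map-suc : ∀ y xs → countLe (suc y) (map suc xs) ≡ countLe y xs
countLe-map-suc y []       = refl
countLe-map-suc y (x ∷ xs) rewrite ≤ᵇ-suc x y =
  cong ((if x ≤ᵇ y then 1 else 0) +_) (countLe-map-suc y xs)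

countLe-1 : ∀ xs → All (2 ≤_) xs → countLe 1 xs ≡ 0
countLe-1 []       []         = refl
countLe-1 (x ∷ xs) (2≤x ∷ pxs) rewrite ≤ᵇ-false 2≤x = countLe-1 xs pxs

arrivalCodes-map-suc : ∀ seen π → arrivalCodes (map suc seen) (map suc π) ≡ arrivalCodes seen π
arrivalCodes-map-suc seen []      = refl
arrivalCodes-map-suc seen (y ∷ π) = cong₂ _∷_ (countLe-map-suc y seen) (begin
  arrivalCodes (map suc seen ++ [ suc y ]) (map suc π)  ≡⟨ cong (λ s → arrivalCodes s (map suc π)) (map-++ suc seen [ y ]) ⟨
  arrivalCodes (map suc (seen ++ [ y ])) (map suc π)    ≡⟨ arrivalCodes-map-suc (seen ++ [ y ]) π ⟩
  arrivalCodes (seen ++ [ y ]) π                        ∎)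
  where open ≡-Reasoning

arrivalCodes-shift : ∀ seen seen′ π → (∀ y → 1 ≤ y → countLe y seen′ ≡ suc (countLe y seen)) →
  All (1 ≤_) π → arrivalCodes seen′ π ≡ map suc (arrivalCodes seen π)
arrivalCodes-shift seen seen′ []      shift _          = refl
arrivalCodes-shift seen seen′ (y ∷ π) shift (1≤y ∷ pπ) =
  cong₂ _∷_ (shift y 1≤y) (arrivalCodes-shift (seen ++ [ y ]) (seen′ ++ [ y ]) π shift′ pπ)
  where
  shift′ : ∀ z → 1 ≤ z → countLe z (seen′ ++ [ y ]) ≡ suc (countLe z (seen ++ [ y ]))
  shift′ z 1≤z rewrite countLe-++ z seen′ [ y ] | countLe-++ z seen [ y ] | shift z 1≤z = refl

arrivalCodes-insertions-1 : ∀ seen τ → All (2 ≤_) seen → All (2 ≤_) τ →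
  map (arrivalCodes seen) (insertions 1 τ) ≡ insertWorst (arrivalCodes seen τ)
arrivalCodes-insertions-1 seen []       2≤seen []           rewrite countLe-1 seen 2≤seen = refl
arrivalCodes-insertions-1 seen (y ∷ ys) 2≤seen (2≤y ∷ 2≤ys) rewrite countLe-1 seen 2≤seen =
  cong₂ _∷_
    (cong (0 ∷_) (arrivalCodes-shift seen (seen ++ [ 1 ]) (y ∷ ys) shift
                    (All.map (≤-trans (s≤s z≤n)) (2≤y ∷ 2≤ys))))
    (begin
      map (arrivalCodes seen) (map (y ∷_) (insertions 1 ys))
        ≡⟨ sym (map-∘ (insertions 1 ys)) ⟩
      map (λ σ → countLe y seen ∷ arrivalCodes (seen ++ [ y ]) σ) (insertions 1 ys)
        ≡⟨ map-∘ (insertions 1 ys) ⟩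
      map (countLe y seen ∷_) (map (arrivalCodes (seen ++ [ y ])) (insertions 1 ys))
        ≡⟨ cong (map (countLe y seen ∷_))
                (arrivalCodes-insertions-1 (seen ++ [ y ]) ys (AllP.++⁺ 2≤seen (2≤y ∷ [])) 2≤ys) ⟩
      map (countLe y seen ∷_) (insertWorst (arrivalCodes (seen ++ [ y ]) ys))
        ∎)
  where
  open ≡-Reasoning
  shift : ∀ z → 1 ≤ z → countLe z (seen ++ [ 1 ]) ≡ suc (countLe z seen)
  shift z 1≤z rewrite countLe-++ z seen [ 1 ] | ≤ᵇ-true 1≤z = +-comm (countLe z seen) 1

insertions-map-suc : ∀ x ys → insertions (suc x) (map suc ys) ≡ map (map suc) (insertions x ys)
insertions-map-suc x []       = refl
insertions-map-suc x (y ∷ ys) = cong ((suc x ∷ suc y ∷ map suc ys) ∷_) (begin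
  map (suc y ∷_) (insertions (suc x) (map suc ys))  ≡⟨ cong (map (suc y ∷_)) (insertions-map-suc x ys) ⟩
  map (suc y ∷_) (map (map suc) (insertions x ys))  ≡⟨ sym (map-∘ (insertions x ys)) ⟩
  map (map suc ∘ (y ∷_)) (insertions x ys)          ≡⟨ map-∘ (insertions x ys) ⟩
  map (map suc) (map (y ∷_) (insertions x ys))      ∎)
  where open ≡-Reasoning

∑-perms-map-suc : ∀ xs f → ∑ (perms (map suc xs)) f ≡ ∑ (perms xs) (f ∘ map suc)
∑-perms-map-suc []       f = refl
∑-perms-map-suc (x ∷ xs) f = begin
  ∑ (concatMap (insertions (suc x)) (perms (map suc xs))) f
    ≡⟨ ∑-concatMap (insertions (suc x)) (perms (map suc xs)) f ⟩
  ∑ (perms (map suc xs)) (λ σ → ∑ (insertions (suc x) σ) f)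
    ≡⟨ ∑-perms-map-suc xs _ ⟩
  ∑ (perms xs) (λ σ → ∑ (insertions (suc x) (map suc σ)) f)
    ≡⟨ ∑-cong (perms xs) (λ σ → trans (cong (λ L → ∑ L f) (insertions-map-suc x σ))
                                      (∑-map (map suc) (insertions x σ) f)) ⟩
  ∑ (perms xs) (λ σ → ∑ (insertions x σ) (f ∘ map suc))
    ≡⟨ sym (∑-concatMap (insertions x) (perms xs) (f ∘ map suc)) ⟩
  ∑ (concatMap (insertions x) (perms xs)) (f ∘ map suc)
    ∎
  where open ≡-Reasoning

oneTo-suc : ∀ N → oneTo (suc N) ≡ 1 ∷ map suc (oneTo N)
oneTo-suc zero    = refl
oneTo-suc (suc N) =
  trans (cong (_++ [ suc (suc N) ]) (oneTo-suc N)) (cong (1 ∷_) (sym (map-++ suc (oneTo N) [ suc N ])))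

insertions-↭ : ∀ (x : ℕ) ys → All (_↭ x ∷ ys) (insertions x ys)
insertions-↭ x []       = ↭-refl ∷ []
insertions-↭ x (y ∷ ys) =
  ↭-refl ∷ AllP.map⁺ (All.map (λ p → ↭-trans (prep y p) (swap y x ↭-refl)) (insertions-↭ x ys))

perms-↭ : ∀ (xs : List ℕ) → All (_↭ xs) (perms xs)
perms-↭ []       = ↭-refl ∷ []
perms-↭ (x ∷ xs) = AllP.concat⁺ (AllP.map⁺ (All.map insertions-↭-x∷xs (perms-↭ xs)))
  where
  insertions-↭-x∷xs : ∀ {σ} → σ ↭ xs → All (_↭ x ∷ xs) (insertions x σ)
  insertions-↭-x∷xs σ↭xs = All.map (λ p → ↭-trans p (prep x σ↭xs)) (insertions-↭ x _)

Distinct : List ℕ → Set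
Distinct []       = ⊤
Distinct (x ∷ xs) = x ∉ xs × Distinct xs

Distinct-resp-↭ : ∀ {xs ys} → xs ↭ ys → Distinct xs → Distinct ys
Distinct-resp-↭ ↭-refl′ d = d
Distinct-resp-↭ (prep x p) (x∉xs , d) = x∉xs ∘ ∈-resp-↭ (↭-sym p) , Distinct-resp-↭ p d
Distinct-resp-↭ (swap x y p) (x∉ , y∉ , d) =
  (λ { (here y≡x) → x∉ (here (sym y≡x)) ; (there y∈) → y∉ (∈-resp-↭ (↭-sym p) y∈) }) ,
  (x∉ ∘ there ∘ ∈-resp-↭ (↭-sym p)) , Distinct-resp-↭ p d
Distinct-resp-↭ (↭-trans′ p q) d = Distinct-resp-↭ q (Distinct-resp-↭ p d)

Distinct-map-suc : ∀ xs → Distinct xs → Distinct (map suc xs)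
Distinct-map-suc []       _            = tt
Distinct-map-suc (x ∷ xs) (x∉xs , d) = x∉xs ∘ suc-∈ , Distinct-map-suc xs d
  where
  suc-∈ : suc x ∈ map suc xs → x ∈ xs
  suc-∈ sx∈ with ∈-map⁻ suc sx∈
  ... | y , y∈ , refl = y∈

oneTo-positive : ∀ N → All (1 ≤_) (oneTo N)
oneTo-positive zero    = []
oneTo-positive (suc N) rewrite oneTo-suc N =
  s≤s z≤n ∷ AllP.map⁺ (All.universal (λ _ → s≤s z≤n) (oneTo N))

oneTo-≤ : ∀ N → All (_≤ N) (oneTo N)
oneTo-≤ zero    = []
oneTo-≤ (suc N) rewrite oneTo-suc N = s≤s z≤n ∷ AllP.map⁺ (All.map s≤s (oneTo-≤ N))

oneTo-distinct : ∀ N → Distinct (oneTo N)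
oneTo-distinct zero    = tt
oneTo-distinct (suc N) rewrite oneTo-suc N = 1∉ , Distinct-map-suc (oneTo N) (oneTo-distinct N)
  where
  1∉ : 1 ∉ map suc (oneTo N)
  1∉ 1∈ with ∈-map⁻ suc 1∈
  ... | y , y∈ , refl = <⇒≱ (All.lookup (oneTo-positive N) y∈) ≤-refl

oneTo-∋ : ∀ N → suc N ∈ oneTo (suc N)
oneTo-∋ zero    = here refl
oneTo-∋ (suc N) rewrite oneTo-suc (suc N) = there (∈-map⁺ suc (oneTo-∋ N))

Valid : ℕ → List ℕ → Set
Valid N π = Distinct π × All (_≤ N) π × All (1 ≤_) π × (0 < N → N ∈ π)

allOrders-valid : ∀ N → All (Valid N) (allOrders N)
allOrders-valid N = All.map valid (perms-↭ (oneTo N))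
  where
  ∋N : ∀ N {π} → π ↭ oneTo N → 0 < N → N ∈ π
  ∋N (suc N) p _ = ∈-resp-↭ (↭-sym p) (oneTo-∋ N)
  valid : ∀ {π} → π ↭ oneTo N → Valid N π
  valid p = Distinct-resp-↭ (↭-sym p) (oneTo-distinct N) , All-resp-↭ (↭-sym p) (oneTo-≤ N) ,
            All-resp-↭ (↭-sym p) (oneTo-positive N) , ∋N N p

∑-allOrders≡∑-permCodes : ∀ N g → ∑ (allOrders N) (g ∘ arrivalCodes []) ≡ ∑ (permCodes N) g
∑-allOrders≡∑-permCodes zero    g = refl
∑-allOrders≡∑-permCodes (suc N) g = begin
  ∑ (perms (oneTo (suc N))) (g ∘ arrivalCodes [])
    ≡⟨ cong (λ xs → ∑ (perms xs) (g ∘ arrivalCodes [])) (oneTo-suc N) ⟩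
  ∑ (concatMap (insertions 1) (perms (map suc (oneTo N)))) (g ∘ arrivalCodes [])
    ≡⟨ ∑-concatMap (insertions 1) (perms (map suc (oneTo N))) _ ⟩
  ∑ (perms (map suc (oneTo N))) (λ τ → ∑ (insertions 1 τ) (g ∘ arrivalCodes []))
    ≡⟨ ∑-perms-map-suc (oneTo N) _ ⟩
  ∑ (allOrders N) (λ σ → ∑ (insertions 1 (map suc σ)) (g ∘ arrivalCodes []))
    ≡⟨ ∑-cong-All (allOrders-valid N) insertWorst-codes ⟩
  ∑ (allOrders N) (λ σ → ∑ (insertWorst (arrivalCodes [] σ)) g)
    ≡⟨ ∑-allOrders≡∑-permCodes N (λ ρ → ∑ (insertWorst ρ) g) ⟩
  ∑ (permCodes N) (λ ρ → ∑ (insertWorst ρ) g)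
    ≡⟨ sym (∑-concatMap insertWorst (permCodes N) g) ⟩
  ∑ (permCodes (suc N)) g
    ∎
  where
  open ≡-Reasoning
  2≤suc : ∀ {xs} → All (1 ≤_) xs → All (2 ≤_) (map suc xs)
  2≤suc = AllP.map⁺ ∘ All.map s≤s
  insertWorst-codes : ∀ {σ} → Valid N σ →
    ∑ (insertions 1 (map suc σ)) (g ∘ arrivalCodes []) ≡ ∑ (insertWorst (arrivalCodes [] σ)) g
  insertWorst-codes {σ} (_ , _ , 1≤σ , _) = begin
    ∑ (insertions 1 (map suc σ)) (g ∘ arrivalCodes [])
      ≡⟨ ∑-map (arrivalCodes []) (insertions 1 (map suc σ)) g ⟨
    ∑ (map (arrivalCodes []) (insertions 1 (map suc σ))) g
      ≡⟨ cong (λ L → ∑ L g) (arrivalCodes-insertions-1 [] (map suc σ) [] (2≤suc 1≤σ)) ⟩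
    ∑ (insertWorst (arrivalCodes [] (map suc σ))) g
      ≡⟨ cong (λ ρ → ∑ (insertWorst ρ) g) (arrivalCodes-map-suc [] σ) ⟩
    ∑ (insertWorst (arrivalCodes [] σ)) g
      ∎

hasZero : List ℕ → Bool
hasZero []       = false
hasZero (x ∷ xs) = (x ≡ᵇ 0) ∨ hasZero xs

∑-codes-suc-withoutZero : ∀ m t h →
  ∑ (codes (suc t) m) (λ σ → if hasZero σ then 0 else h σ) ≡ ∑ (codes t m) (h ∘ map suc)
∑-codes-suc-withoutZero zero    t h = refl
∑-codes-suc-withoutZero (suc m) t h = begin
  ∑ (codes (suc t) (suc m)) K
    ≡⟨ ∑-codes-suc (suc t) m K ⟩
  ∑ C (λ _ → 0) + ∑ (map suc (range (suc t))) (λ x → ∑ C (K ∘ (x ∷_)))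
    ≡⟨ cong₂ _+_ (∑-zero C (λ _ → refl)) (∑-map suc (range (suc t)) _) ⟩
  ∑ (range (suc t)) (λ y → ∑ C (K ∘ (suc y ∷_)))
    ≡⟨ ∑-cong (range (suc t)) (λ y → ∑-codes-suc-withoutZero m (suc t) (h ∘ (suc y ∷_))) ⟩
  ∑ (range (suc t)) (λ y → ∑ (codes (suc t) m) (λ ρ → h (suc y ∷ map suc ρ)))
    ≡⟨ ∑-codes-suc t m (h ∘ map suc) ⟨
  ∑ (codes t (suc m)) (h ∘ map suc)
    ∎
  where
  open ≡-Reasoning
  K : List ℕ → ℕ
  K σ = if hasZero σ then 0 else h σ
  C : List (List ℕ)
  C = codes (suc (suc t)) m

if-∨-split : ∀ b c (v : ℕ) →
  (if b ∨ c then v else 0) ≡ (if c then v else 0) + (if c then 0 else (if b then v else 0))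
if-∨-split true  true  v = sym (+-identityʳ v)
if-∨-split true  false v = refl
if-∨-split false true  v = sym (+-identityʳ v)
if-∨-split false false v = refl

if-0-0 : ∀ (b : Bool) → (if b then 0 else 0) ≡ 0
if-0-0 true  = refl
if-0-0 false = refl

∑-hasZero-split : ∀ t n (g : List ℕ → ℕ) →
  ∑ (codes t (suc n)) (λ σ → if hasZero σ then g σ else 0) ≡
  ∑ (range (suc t)) (λ x → ∑ (codes (suc t) n) (λ σ → if hasZero σ then g (x ∷ σ) else 0))
  + ∑ (codes (suc t) n) (λ σ → if hasZero σ then 0 else g (0 ∷ σ))
∑-hasZero-split t n g = begin
  ∑ (codes t (suc n)) K
    ≡⟨ ∑-codes-suc t n K ⟩
  ∑ R (λ x → ∑ C (K ∘ (x ∷_)))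
    ≡⟨ ∑-cong R (λ x → trans (∑-cong C (λ σ → if-∨-split (x ≡ᵇ 0) (hasZero σ) (g (x ∷ σ))))
                             (∑-+ C (zeroInTail x) (onlyZeroFirst x))) ⟩
  ∑ R (λ x → ∑ C (zeroInTail x) + ∑ C (onlyZeroFirst x))
    ≡⟨ ∑-+ R (λ x → ∑ C (zeroInTail x)) (λ x → ∑ C (onlyZeroFirst x)) ⟩
  ∑ R (λ x → ∑ C (zeroInTail x)) + ∑ R (λ x → ∑ C (onlyZeroFirst x))
    ≡⟨ cong (∑ R (λ x → ∑ C (zeroInTail x)) +_) firstIsZero ⟩
  ∑ R (λ x → ∑ C (zeroInTail x)) + ∑ C (onlyZeroFirst 0)
    ∎
  where
  open ≡-Reasoning
  R : List ℕ
  R = range (suc t)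
  C : List (List ℕ)
  C = codes (suc t) n
  K : List ℕ → ℕ
  K σ = if hasZero σ then g σ else 0
  zeroInTail onlyZeroFirst : ℕ → List ℕ → ℕ
  zeroInTail    x σ = if hasZero σ then g (x ∷ σ) else 0
  onlyZeroFirst x σ = if hasZero σ then 0 else (if x ≡ᵇ 0 then g (x ∷ σ) else 0)
  firstIsZero : ∑ R (λ x → ∑ C (onlyZeroFirst x)) ≡ ∑ C (onlyZeroFirst 0)
  firstIsZero = trans (cong (∑ C (onlyZeroFirst 0) +_)
                        (trans (∑-map suc (range t) _) (∑-zero (range t) (λ _ → ∑-zero C (if-0-0 ∘ hasZero)))))
                      (+-identityʳ _)

-- The inserted worst applicant is the last arrival with code 0.
∑-insertWorst : ∀ n t g →
  ∑ (codes t n) (λ ρ → ∑ (insertWorst ρ) g) ≡ ∑ (codes t (suc n)) (λ σ → if hasZero σ then g σ else 0)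
∑-insertWorst zero t g = begin
  (g (0 ∷ []) + 0) + 0                                             ≡⟨ cong ((g (0 ∷ []) + 0) +_) noOtherZero ⟨
  (g (0 ∷ []) + 0) + ∑ (map suc (range t)) (λ x → K (x ∷ []) + 0)  ≡⟨ ∑-codes-suc t 0 K ⟨
  ∑ (codes t 1) K                                                  ∎
  where
  open ≡-Reasoning
  K : List ℕ → ℕ
  K σ = if hasZero σ then g σ else 0
  noOtherZero : ∑ (map suc (range t)) (λ x → K (x ∷ []) + 0) ≡ 0
  noOtherZero = trans (∑-map suc (range t) _) (∑-zero (range t) (λ _ → refl))
∑-insertWorst (suc n) t g = begin
  ∑ (codes t (suc n)) (λ ρ → ∑ (insertWorst ρ) g)
    ≡⟨ ∑-codes-suc t n _ ⟩
  ∑ R (λ x → ∑ C (λ ρ → new x ρ + old x ρ))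
    ≡⟨ ∑-cong R (λ x → ∑-+ C (new x) (old x)) ⟩
  ∑ R (λ x → ∑ C (new x) + ∑ C (old x))
    ≡⟨ ∑-+ R (λ x → ∑ C (new x)) (λ x → ∑ C (old x)) ⟩
  ∑ R (λ x → ∑ C (new x)) + ∑ R (λ x → ∑ C (old x))
    ≡⟨ cong₂ _+_ newFirst newLater ⟩
  ∑ C′ onlyZeroFirst + ∑ R (λ x → ∑ C′ (zeroInTail x))
    ≡⟨ +-comm (∑ C′ onlyZeroFirst) _ ⟩
  ∑ R (λ x → ∑ C′ (zeroInTail x)) + ∑ C′ onlyZeroFirst
    ≡⟨ ∑-hasZero-split t (suc n) g ⟨
  ∑ (codes t (suc (suc n))) (λ σ → if hasZero σ then g σ else 0)
    ∎
  where
  open ≡-Reasoning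
  R : List ℕ
  R = range (suc t)
  C C′ : List (List ℕ)
  C  = codes (suc t) n
  C′ = codes (suc t) (suc n)
  new old : ℕ → List ℕ → ℕ
  new x ρ = g (0 ∷ suc x ∷ map suc ρ)
  old x ρ = ∑ (map (x ∷_) (insertWorst ρ)) g
  onlyZeroFirst : List ℕ → ℕ
  onlyZeroFirst σ = if hasZero σ then 0 else g (0 ∷ σ)
  zeroInTail : ℕ → List ℕ → ℕ
  zeroInTail x σ = if hasZero σ then g (x ∷ σ) else 0
  newFirst : ∑ R (λ x → ∑ C (new x)) ≡ ∑ C′ onlyZeroFirst
  newFirst = trans (sym (∑-codes-suc t n (λ ρ → g (0 ∷ map suc ρ))))
                   (sym (∑-codes-suc-withoutZero (suc n) t (λ σ → g (0 ∷ σ))))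
  newLater : ∑ R (λ x → ∑ C (old x)) ≡ ∑ R (λ x → ∑ C′ (zeroInTail x))
  newLater = ∑-cong R (λ x →
    trans (∑-cong C (λ ρ → ∑-map (x ∷_) (insertWorst ρ) g)) (∑-insertWorst n (suc t) (λ σ → g (x ∷ σ))))

∑-permCodes≡∑-codes : ∀ N g → ∑ (permCodes N) g ≡ ∑ (codes 0 N) g
∑-permCodes≡∑-codes zero    g = refl
∑-permCodes≡∑-codes (suc N) g = begin
  ∑ (concatMap insertWorst (permCodes N)) g                ≡⟨ ∑-concatMap insertWorst (permCodes N) g ⟩
  ∑ (permCodes N) (λ ρ → ∑ (insertWorst ρ) g)               ≡⟨ ∑-permCodes≡∑-codes N _ ⟩
  ∑ (codes 0 N) (λ ρ → ∑ (insertWorst ρ) g)                 ≡⟨ ∑-insertWorst N 0 g ⟩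
  ∑ (codes 0 (suc N)) (λ σ → if hasZero σ then g σ else 0)  ≡⟨ ∑-codes-suc 0 N _ ⟩
  ∑ (codes 1 N) (λ σ → g (0 ∷ σ)) + 0                      ≡⟨ ∑-codes-suc 0 N g ⟨
  ∑ (codes 0 (suc N)) g                                    ∎
  where open ≡-Reasoning

Distinct-split : ∀ xs x ys → Distinct (xs ++ x ∷ ys) → x ∉ xs × x ∉ ys
Distinct-split []       x ys (x∉ys , _) = (λ ()) , x∉ys
Distinct-split (z ∷ xs) x ys (z∉ , d) with Distinct-split xs x ys d
... | x∉xs , x∉ys = x∉z∷xs , x∉ys
  where
  x∉z∷xs : x ∉ z ∷ xs
  x∉z∷xs (here x≡z) = z∉ (∈-++⁺ʳ xs (here (sym x≡z)))
  x∉z∷xs (there x∈) = x∉xs x∈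

countLe-mono : ∀ xs {y z} → y ≤ z → countLe y xs ≤ countLe z xs
countLe-mono []       y≤z = z≤n
countLe-mono (w ∷ xs) {y} {z} y≤z with w ≤ᵇ y in w≤y
... | true rewrite ≤ᵇ-true (≤-trans (≤ᵇ-true⇒≤ w y w≤y) y≤z) = s≤s (countLe-mono xs y≤z)
... | false = ≤-trans (countLe-mono xs y≤z) (m≤n+m _ _)

countLe-< : ∀ xs {y z} → y < z → z ∈ xs → countLe y xs < countLe z xs
countLe-< (w ∷ xs) {y} {z} y<z (here refl) rewrite ≤ᵇ-false y<z | ≤ᵇ-true (≤-refl {z}) =
  s≤s (countLe-mono xs (<⇒≤ y<z))
countLe-< (w ∷ xs) {y} {z} y<z (there z∈) = +-mono-≤-< indicator-mono (countLe-< xs y<z z∈)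
  where
  indicator-mono : (if w ≤ᵇ y then 1 else 0) ≤ (if w ≤ᵇ z then 1 else 0)
  indicator-mono with w ≤ᵇ y in w≤y
  ... | true rewrite ≤ᵇ-true (≤-trans (≤ᵇ-true⇒≤ w y w≤y) (<⇒≤ y<z)) = ≤-refl
  ... | false = z≤n

countLe-≤-length : ∀ y xs → countLe y xs ≤ length xs
countLe-≤-length y []       = z≤n
countLe-≤-length y (w ∷ xs) with w ≤ᵇ y
... | true  = s≤s (countLe-≤-length y xs)
... | false = ≤-trans (countLe-≤-length y xs) (n≤1+n _)

countLe≡length⇒All≤ : ∀ y xs → countLe y xs ≡ length xs → All (_≤ y) xs
countLe≡length⇒All≤ y []       _  = []
countLe≡length⇒All≤ y (w ∷ xs) eq with w ≤ᵇ y in w≤y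
... | true  = ≤ᵇ-true⇒≤ w y w≤y ∷ countLe≡length⇒All≤ y xs (suc-injective eq)
... | false = ⊥-elim (<⇒≱ (≤-reflexive (sym eq)) (countLe-≤-length y xs))

All≤⇒countLe≡length : ∀ y xs → All (_≤ y) xs → countLe y xs ≡ length xs
All≤⇒countLe≡length y []       _            = refl
All≤⇒countLe≡length y (w ∷ xs) (w≤y ∷ xs≤y) rewrite ≤ᵇ-true w≤y =
  cong suc (All≤⇒countLe≡length y xs xs≤y)

relPattern-++ : ∀ seen x → x ∉ seen → relPattern (seen ++ [ x ]) ≡ extend (countLe x seen) (relPattern seen)
relPattern-++ seen x x∉seen =
  trans (map-++ (λ z → countLe z (seen ++ [ x ])) seen [ x ])
        (cong₂ _++_ (trans (map-cong-local (All.tabulate rank-bumped)) (map-∘ seen)) (cong [_] rank-new))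
  where
  c : ℕ
  c = countLe x seen
  rank-bumped : ∀ {z} → z ∈ seen → countLe z (seen ++ [ x ]) ≡ bump c (countLe z seen)
  rank-bumped {z} z∈ rewrite countLe-++ z seen [ x ] with <-cmp x z
  ... | tri< x<z _ _ rewrite ≤ᵇ-true (<⇒≤ x<z) | <ᵇ-true (countLe-< seen x<z z∈) = +-comm (countLe z seen) 1
  ... | tri≈ _ refl _ = ⊥-elim (x∉seen z∈)
  ... | tri> _ _ z<x rewrite ≤ᵇ-false z<x | <ᵇ-false (countLe-mono seen (<⇒≤ z<x)) = +-identityʳ _
  rank-new : countLe x (seen ++ [ x ]) ≡ suc c
  rank-new rewrite countLe-++ x seen [ x ] | ≤ᵇ-true (≤-refl {x}) = +-comm c 1

allBelow : ℕ → List ℕ → Bool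
allBelow x []       = true
allBelow x (y ∷ ys) = (y <ᵇ x) ∧ allBelow x ys

noRecord-arrivalCodes : ∀ seen x ys → x ∈ seen → All (_≤ x) seen → x ∉ ys →
  noRecord (length seen) (arrivalCodes seen ys) ≡ allBelow x ys
noRecord-arrivalCodes seen x []       x∈ seen≤x x∉ = refl
noRecord-arrivalCodes seen x (y ∷ ys) x∈ seen≤x x∉ with <-cmp y x
... | tri< y<x _ _
  rewrite ≡ᵇ-false (<⇒≢ (<-≤-trans (countLe-< seen y<x x∈) (countLe-≤-length x seen))) | <ᵇ-true y<x =
  trans (cong (λ t → noRecord t (arrivalCodes (seen ++ [ y ]) ys)) (sym (length-++-[] seen y)))
        (noRecord-arrivalCodes (seen ++ [ y ]) x ys (∈-++⁺ˡ x∈) (AllP.++⁺ seen≤x (<⇒≤ y<x ∷ [])) (x∉ ∘ there))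
... | tri≈ _ refl _ = ⊥-elim (x∉ (here refl))
... | tri> _ _ x<y
  rewrite All≤⇒countLe≡length y seen (All.map (λ w≤x → ≤-trans w≤x (<⇒≤ x<y)) seen≤x) | ≡ᵇ-refl (length seen)
        | <ᵇ-false (<⇒≤ x<y) = refl

allBelow-true : ∀ x ys → All (_≤ x) ys → x ∉ ys → allBelow x ys ≡ true
allBelow-true x []       _            _  = refl
allBelow-true x (y ∷ ys) (y≤x ∷ ys≤x) x∉ with m≤n⇒m<n∨m≡n y≤x
... | inj₂ refl = ⊥-elim (x∉ (here refl))
... | inj₁ y<x rewrite <ᵇ-true y<x = allBelow-true x ys ys≤x (x∉ ∘ there)

allBelow-false : ∀ x ys z → z ∈ ys → x ≤ z → allBelow x ys ≡ false
allBelow-false x (y ∷ ys) z (here refl) x≤z rewrite <ᵇ-false x≤z = refl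
allBelow-false x (y ∷ ys) z (there z∈) x≤z with y <ᵇ x
... | true  = allBelow-false x ys z z∈ x≤z
... | false = refl

best-iff-lastRecord : ∀ N seen x ys →
  Distinct (seen ++ x ∷ ys) → All (_≤ N) (seen ++ x ∷ ys) → N ∈ seen ++ x ∷ ys →
  (N ≡ᵇ x) ≡ ((countLe x seen ≡ᵇ length seen) ∧ noRecord (suc (length seen)) (arrivalCodes (seen ++ [ x ]) ys))
best-iff-lastRecord N seen x ys d all≤N N∈
  with Distinct-split seen x ys d | AllP.++⁻ seen all≤N | countLe x seen ≡ᵇ length seen in isRecord
... | x∉seen , x∉ys | seen≤N , x≤N ∷ ys≤N | false = ≡ᵇ-false N≢x
  where
  N≢x : N ≢ x
  N≢x refl = subst T isRecord (≡⇒≡ᵇ _ _ (All≤⇒countLe≡length N seen seen≤N))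
... | x∉seen , x∉ys | seen≤N , x≤N ∷ ys≤N | true = trans best-iff-allBelow (sym (trans
  (cong (λ t → noRecord t (arrivalCodes (seen ++ [ x ]) ys)) (sym (length-++-[] seen x)))
  (noRecord-arrivalCodes (seen ++ [ x ]) x ys (∈-++⁺ʳ seen (here refl)) (AllP.++⁺ seen≤x (≤-refl ∷ [])) x∉ys)))
  where
  seen≤x : All (_≤ x) seen
  seen≤x = countLe≡length⇒All≤ x seen (≡ᵇ-true⇒≡ isRecord)
  best-iff-allBelow : (N ≡ᵇ x) ≡ allBelow x ys
  best-iff-allBelow with N ≟ x
  ... | yes refl = trans (≡ᵇ-refl N) (sym (allBelow-true N ys ys≤N x∉ys))
  ... | no N≢x with ∈-++⁻ seen N∈
  ...   | inj₁ N∈seen        = ⊥-elim (N≢x (≤-antisym (All.lookup seen≤x N∈seen) x≤N))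
  ...   | inj₂ (here N≡x)    = ⊥-elim (N≢x N≡x)
  ...   | inj₂ (there N∈ys)  = trans (≡ᵇ-false N≢x) (sym (allBelow-false x ys N N∈ys x≤N))

wins≡winsFrom : ∀ N S rem made seen π →
  Distinct (seen ++ π) → All (_≤ N) (seen ++ π) → N ∈ seen ++ π →
  memb N (run S rem made seen π) ≡ winsFrom S rem made (relPattern seen) (length seen) (arrivalCodes seen π)
wins≡winsFrom N S rem     made seen []       _ _     _  = refl
wins≡winsFrom N S zero    made seen (x ∷ xs) _ _     _  = refl
wins≡winsFrom N S (suc r) made seen (x ∷ xs) d all≤N N∈ = arrival
  where
  x∉seen : x ∉ seen
  x∉seen = proj₁ (Distinct-split seen x xs d)
  IH : ∀ r made → memb N (run S r made (seen ++ [ x ]) xs) ≡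
       winsFrom S r made (extend (countLe x seen) (relPattern seen)) (suc (length seen))
                (arrivalCodes (seen ++ [ x ]) xs)
  IH r made = trans
    (wins≡winsFrom N S r made (seen ++ [ x ]) xs
      (subst Distinct reassoc d) (subst (All (_≤ N)) reassoc all≤N) (subst (N ∈_) reassoc N∈))
    (cong₂ (λ pat t → winsFrom S r made pat t (arrivalCodes (seen ++ [ x ]) xs))
           (relPattern-++ seen x x∉seen) (length-++-[] seen x))
    where
    reassoc : seen ++ x ∷ xs ≡ (seen ++ [ x ]) ++ xs
    reassoc = sym (++-assoc seen [ x ] xs)
  arrival : memb N (run S (suc r) made seen (x ∷ xs)) ≡
            winsFrom S (suc r) made (relPattern seen) (length seen) (arrivalCodes seen (x ∷ xs))
  arrival rewrite relPattern-++ seen x x∉seen with S made (extend (countLe x seen) (relPattern seen))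
  ... | true  = cong₂ _∨_ (best-iff-lastRecord N seen x xs d all≤N N∈) (IH r (suc made))
  ... | false = IH (suc r) made

winCount≡∑-winsFrom : ∀ N s S → 0 < N → winCount N s S ≡ ∑ (codes 0 N) (bit ∘ winsFrom S s 0 [] 0)
winCount≡∑-winsFrom N s S 0<N = begin
  countTrue (map (wins N S s) (allOrders N))           ≡⟨ countTrue≡∑bit (map (wins N S s) (allOrders N)) ⟩
  ∑ (map (wins N S s) (allOrders N)) bit               ≡⟨ ∑-map (wins N S s) (allOrders N) bit ⟩
  ∑ (allOrders N) (bit ∘ wins N S s)                   ≡⟨ ∑-cong-All (allOrders-valid N) wins-codes ⟩
  ∑ (allOrders N) (w ∘ arrivalCodes [])                ≡⟨ ∑-allOrders≡∑-permCodes N w ⟩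
  ∑ (permCodes N) w                                    ≡⟨ ∑-permCodes≡∑-codes N w ⟩
  ∑ (codes 0 N) w                                      ∎
  where
  open ≡-Reasoning
  w : List ℕ → ℕ
  w = bit ∘ winsFrom S s 0 [] 0
  wins-codes : ∀ {π} → Valid N π → bit (wins N S s π) ≡ w (arrivalCodes [] π)
  wins-codes {π} (d , all≤N , _ , N∈) = cong bit (wins≡winsFrom N S s 0 [] π d all≤N (N∈ 0<N))

mainTheorem9 : (N : ℕ) → 0 < N →
  ∃ λ (a : ℕ → ℕ) →
    (a 1 ≤ N) × (∀ i → 1 ≤ i → a (suc i) ≤ a i) ×
    (∀ s → 1 ≤ s → Optimal N s (thresholdStrategy (revThresholds a s)))
mainTheorem9 N 0<N = threshold N , threshold-1-≤ N , threshold-antitone N , optimal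
  where
  open ≤-Reasoning
  S : ℕ → Strategy
  S s = thresholdStrategy (revThresholds (threshold N) s)
  attains : ∀ s → ∑ (codes 0 N) (bit ∘ winsFrom (S s) s 0 [] 0) ≡ bestWins s 0 N
  attains s = ∑-winsFrom-threshold≡bestWins N (threshold N)
                (accept-from-threshold N) (reject-before-threshold N) N s 0 [] refl
  optimal : ∀ s → 1 ≤ s → Optimal N s (S s)
  optimal s _ T = begin
    winCount N s T                                 ≡⟨ winCount≡∑-winsFrom N s T 0<N ⟩
    ∑ (codes 0 N) (bit ∘ winsFrom T s 0 [] 0)      ≤⟨ ∑-winsFrom-≤-bestWins T N s 0 [] 0 ⟩
    bestWins s 0 N                                 ≡⟨ attains s ⟨
    ∑ (codes 0 N) (bit ∘ winsFrom (S s) s 0 [] 0)  ≡⟨ winCount≡∑-winsFrom N s (S s) 0<N ⟨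
    winCount N s (S s)                             ∎
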